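{- Let $d\ge4$ be an integer, and let $v$ be a vertex of a directed graph with in-degree $s$ and out-degree $r$ where $\max(s,r)>d$. Then the Splitting Procedure applied to $v$ (with parameter $d$) terminates after finitely many replacements.
   Context: Directed graphs have no loops and no two arcs with the same tail and head (an undirected edge is regarded as two opposite arcs). A split replaces a vertex $w$ by two vertices $p,q$ with the arc $(p,q)$: all arcs into $w$ become arcs into $p$, and all arcs out of $w$ become arcs out of $q$. An in-split replaces $w$ by three vertices $p,q,t$ with arcs $(p,q),(q,p),(p,t),(q,t)$: the arcs into $w$ are divided between $p$ and $q$ so that the numbers differ by at most one, and all arcs out of $w$ become arcs out of $t$. An out-split replaces $w$ by three vertices $p,q,t$ with arcs $(p,q),(p,t),(q,t),(t,q)$: all arcs into $w$ become arcs into $p$, and the arcs out of $w$ are divided between $q$ and $t$ so that the numbers differ by at most one. Splitting Procedure for $v$ with parameter $d$: (i) replace $v$ with a split; (ii) while some vertex of the subgraph replacing $v$ has in-degree greater than $d$, replace that vertex with an in-split; (iii) while some vertex of the subgraph replacing $v$ has out-degree greater than $d$, replace that vertex with an out-split. -}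

module Defs where

open import Data.Nat using (ℕ; zero; suc; _≤_; _<_; _⊔_)
open import Data.Fin using (Fin; zero; suc; _≟_)
open import Data.Bool using (Bool; true; false; not; _∧_; _∨_; if_then_else_; T)
open import Data.List using (List; allFin; map)
open import Data.Nat.ListAction using (sum)
open import Data.Product using (_×_; Σ; _,_)
open import Relation.Nullary.Decidable using (⌊_⌋)
open import Induction.WellFounded using (Acc)

-- Multiple arcs with the
-- same tail and head are impossible by construction; loops are excluded
-- by the predicate Loopless.  An undirected edge is two opposite arcs.
Digraph : ℕ → Set
Digraph n = Fin n → Fin n → Bool

Loopless : ∀ {n} → Digraph n → Set
Loopless {n} G = (x : Fin n) → G x x ≡ false
  where open import Relation.Binary.PropositionalEquality using (_≡_)

_==_ : ∀ {n} → Fin n → Fin n → Bool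
x == y = ⌊ x ≟ y ⌋

count : ∀ {n} → (Fin n → Bool) → ℕ
count {n} f = sum (map (λ u → if f u then 1 else 0) (allFin n))

indeg : ∀ {n} → Digraph n → Fin n → ℕ
indeg G w = count (λ u → G u w)

outdeg : ∀ {n} → Digraph n → Fin n → ℕ
outdeg G w = count (λ u → G w u)

-- New vertex set Fin (suc n): zero = q (new), suc w = p
-- (occupies the slot of w), suc x = x for the other old vertices.
-- Arc (p,q); arcs into w go into p; arcs out of w go out of q.

split : ∀ {n} → Digraph n → Fin n → Digraph (suc n)
split G w (suc x) (suc y) = if x == w then false else G x y
split G w (suc x) zero    = x == w
split G w zero    (suc y) = G w y
split G w zero    zero    = false

BalancedIn : ∀ {n} → Digraph n → Fin n → (Fin n → Bool) → Set
BalancedIn G w chi =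
  (count (λ u → G u w ∧ chi u) ≤ suc (count (λ u → G u w ∧ not (chi u)))) ×
  (count (λ u → G u w ∧ not (chi u)) ≤ suc (count (λ u → G u w ∧ chi u)))

BalancedOut : ∀ {n} → Digraph n → Fin n → (Fin n → Bool) → Set
BalancedOut G w chi =
  (count (λ u → G w u ∧ chi u) ≤ suc (count (λ u → G w u ∧ not (chi u)))) ×
  (count (λ u → G w u ∧ not (chi u)) ≤ suc (count (λ u → G w u ∧ chi u)))

-- In-split of w with division chi of the in-neighbours of w
-- (chi u = true : the arc (u,w) becomes (u,q); false : becomes (u,p)).
-- New vertex set Fin (suc (suc n)): zero = q, suc zero = t,
-- suc (suc w) = p, suc (suc x) = x for the other old vertices.
-- Arcs (p,q),(q,p),(p,t),(q,t); arcs out of w become arcs out of t.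

inSplit : ∀ {n} → Digraph n → Fin n → (Fin n → Bool) → Digraph (suc (suc n))
inSplit G w chi (suc (suc x)) (suc (suc y)) =
  if x == w then false else (if y == w then G x w ∧ not (chi x) else G x y)
inSplit G w chi (suc (suc x)) zero       = (x == w) ∨ (G x w ∧ chi x)
inSplit G w chi (suc (suc x)) (suc zero) = x == w
inSplit G w chi zero (suc (suc y))       = y == w
inSplit G w chi zero (suc zero)          = true
inSplit G w chi zero zero                = false
inSplit G w chi (suc zero) (suc (suc y)) = if y == w then false else G w y
inSplit G w chi (suc zero) zero          = false
inSplit G w chi (suc zero) (suc zero)    = false

-- Out-split of w with division chi of the out-neighbours of w
-- (chi y = true : the arc (w,y) becomes (q,y); false : becomes (t,y)).
-- New vertex set Fin (suc (suc n)): zero = q, suc zero = t,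
-- suc (suc w) = p, suc (suc x) = x for the other old vertices.
-- Arcs (p,q),(p,t),(q,t),(t,q); arcs into w become arcs into p.

outSplit : ∀ {n} → Digraph n → Fin n → (Fin n → Bool) → Digraph (suc (suc n))
outSplit G w chi (suc (suc x)) (suc (suc y)) = if x == w then false else G x y
outSplit G w chi (suc (suc x)) zero       = x == w
outSplit G w chi (suc (suc x)) (suc zero) = x == w
outSplit G w chi zero (suc (suc y))       = G w y ∧ chi y
outSplit G w chi zero (suc zero)          = true
outSplit G w chi zero zero                = false
outSplit G w chi (suc zero) (suc (suc y)) = G w y ∧ not (chi y)
outSplit G w chi (suc zero) zero          = true
outSplit G w chi (suc zero) (suc zero)    = false

-- States of the Splitting Procedure.
-- pre v : step (i) not yet performed, v is the vertex to be split;
-- inPhase : step (ii) running;  outPhase : step (iii) running.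

data Phase (n : ℕ) : Set where
  pre      : Fin n → Phase n
  inPhase  : Phase n
  outPhase : Phase n

record State : Set where
  constructor state
  field
    size  : ℕ
    graph : Digraph size
    sub   : Fin size → Bool     -- vertices of the subgraph replacing v
    phase : Phase size

subSplit : ∀ {n} → (Fin n → Bool) → Fin n → Fin (suc n) → Bool
subSplit S w zero    = true
subSplit S w (suc x) = (x == w) ∨ S x

subSplit3 : ∀ {n} → (Fin n → Bool) → Fin (suc (suc n)) → Bool
subSplit3 S zero          = true
subSplit3 S (suc zero)    = true
subSplit3 S (suc (suc x)) = S x

data Step (d : ℕ) : State → State → Set where
  stepSplit : ∀ {n} (G : Digraph n) (S : Fin n → Bool) (v : Fin n) →
    Step d (state n G S (pre v))
           (state (suc n) (split G v) (subSplit S v) inPhase)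
  stepIn : ∀ {n} (G : Digraph n) (S : Fin n → Bool) (w : Fin n)
    (chi : Fin n → Bool) →
    T (S w) → d < indeg G w → BalancedIn G w chi →
    Step d (state n G S inPhase)
           (state (suc (suc n)) (inSplit G w chi) (subSplit3 S) inPhase)
  stepOutStart : ∀ {n} (G : Digraph n) (S : Fin n → Bool) (w : Fin n)
    (chi : Fin n → Bool) →
    ((x : Fin n) → T (S x) → indeg G x ≤ d) →
    T (S w) → d < outdeg G w → BalancedOut G w chi →
    Step d (state n G S inPhase)
           (state (suc (suc n)) (outSplit G w chi) (subSplit3 S) outPhase)
  stepOut : ∀ {n} (G : Digraph n) (S : Fin n → Bool) (w : Fin n)
    (chi : Fin n → Bool) →
    T (S w) → d < outdeg G w → BalancedOut G w chi →
    Step d (state n G S outPhase)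
           (state (suc (suc n)) (outSplit G w chi) (subSplit3 S) outPhase)

-- The procedure terminates (after finitely many replacements, whatever
-- choices are made) from state σ: every sequence of steps from σ is
-- finite, i.e. σ is accessible for the converse step relation.
Terminates : ℕ → State → Set
Terminates d σ = Acc (λ τ σ' → Step d σ' τ) σ

initial : ∀ {n} → Digraph n → Fin n → State
initial {n} G v = state n G (λ _ → false) (pre v)

-- Measure the in-degrees of a digraph by their excess Σ max(0, deg − 3).
-- An in-split of a vertex w of in-degree s ≥ 5 divides its in-arcs into
-- halves a, b that differ by at most one, hence a, b ≥ 2; the new vertices
-- receive in-degrees at most a + 1, b + 1 and 2, so the contribution s − 3
-- of w is replaced by at most (a − 2) + (b − 2) = s − 4, while every other
-- in-degree is unchanged.  Thus each step (ii) lowers the in-excess, and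
-- dually each step (iii) lowers the out-excess; step (i) happens once.
module Submission where

open import Defs
open import Data.Nat.Properties hiding (_≟_; suc-injective)
open import Algebra.Properties.CommutativeMonoid.Sum +-0-commutativeMonoid
  using (sum; sum-cong-≗; ∑-distrib-+; sum-replicate-zero)
open import Algebra.Properties.CommutativeSemigroup +-commutativeSemigroup
  using (xy∙z≈zy∙x)
open import Data.Bool using (Bool; true; false; not; _∧_; _∨_; if_then_else_)
open import Data.Fin using (Fin; zero; suc; _≟_)
open import Data.Fin.Properties using (suc-injective)
open import Data.List using (tabulate)
open import Data.List.Properties using (map-tabulate)
open import Data.Nat using (ℕ; zero; suc; _+_; _∸_; _≤_; _<_; _⊔_; z≤n; s≤s)
open import Data.Nat.Induction using (<-wellFounded)
import Data.Nat.ListAction as ListAction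
open import Data.Nat.Tactic.RingSolver using (solve-∀)
open import Data.Product using (_,_)
open import Function using (id; _∘_)
open import Induction.WellFounded using (Acc; acc)
open import Relation.Binary.PropositionalEquality
open import Relation.Nullary.Decidable using (isYes≗does; dec-true; dec-false)

==-refl : ∀ {n} (w : Fin n) → (w == w) ≡ true
==-refl w = trans (isYes≗does (w ≟ w)) (dec-true (w ≟ w) refl)

≢⇒==-false : ∀ {n} {x w : Fin n} → x ≢ w → (x == w) ≡ false
≢⇒==-false {x = x} {w} x≢w = trans (isYes≗does (x ≟ w)) (dec-false (x ≟ w) x≢w)

𝟙 : Bool → ℕ
𝟙 b = if b then 1 else 0

𝟙-∨ : ∀ a b → 𝟙 (a ∨ b) ≤ 𝟙 a + 𝟙 b
𝟙-∨ true  b = s≤s z≤n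
𝟙-∨ false b = ≤-refl

𝟙-∧-not : ∀ a b → 𝟙 (a ∧ b) + 𝟙 (a ∧ not b) ≡ 𝟙 a
𝟙-∧-not true  true  = refl
𝟙-∧-not true  false = refl
𝟙-∧-not false b     = refl

sum-mono-≤ : ∀ {n} {f g : Fin n → ℕ} → (∀ x → f x ≤ g x) → sum f ≤ sum g
sum-mono-≤ {zero}  f≤g = z≤n
sum-mono-≤ {suc n} f≤g = +-mono-≤ (f≤g zero) (sum-mono-≤ (f≤g ∘ suc))

sum-update : ∀ {n} {f g : Fin n → ℕ} (w : Fin n) →
  (∀ x → x ≢ w → f x ≡ g x) → sum f + g w ≡ sum g + f w
sum-update {f = f} {g} zero agree = begin
  f zero + sum (f ∘ suc) + g zero
    ≡⟨ cong (λ s → f zero + s + g zero)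
         (sum-cong-≗ (λ x → agree (suc x) λ ())) ⟩
  f zero + sum (g ∘ suc) + g zero
    ≡⟨ xy∙z≈zy∙x (f zero) (sum (g ∘ suc)) (g zero) ⟩
  g zero + sum (g ∘ suc) + f zero ∎
  where open ≡-Reasoning
sum-update {f = f} {g} (suc w) agree = begin
  f zero + sum (f ∘ suc) + g (suc w)   ≡⟨ +-assoc (f zero) _ _ ⟩
  f zero + (sum (f ∘ suc) + g (suc w))
    ≡⟨ cong₂ _+_ (agree zero λ ())
         (sum-update w (λ x x≢w → agree (suc x) (x≢w ∘ suc-injective))) ⟩
  g zero + (sum (g ∘ suc) + f (suc w)) ≡⟨ +-assoc (g zero) _ _ ⟨
  g zero + sum (g ∘ suc) + f (suc w)   ∎
  where open ≡-Reasoning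

count-sum : ∀ {n} (f : Fin n → Bool) → count f ≡ sum (𝟙 ∘ f)
count-sum f =
  trans (cong ListAction.sum (map-tabulate id (𝟙 ∘ f))) (sum-tabulate (𝟙 ∘ f))
  where
  sum-tabulate : ∀ {m} (h : Fin m → ℕ) → ListAction.sum (tabulate h) ≡ sum h
  sum-tabulate {zero}  h = refl
  sum-tabulate {suc m} h = cong (h zero +_) (sum-tabulate (h ∘ suc))

count-suc-suc : ∀ {n} (f : Fin (suc (suc n)) → Bool) {a b : Bool} {g : Fin n → Bool} →
  f zero ≡ a → f (suc zero) ≡ b → (∀ x → f (suc (suc x)) ≡ g x) →
  count f ≡ 𝟙 a + (𝟙 b + count g)
count-suc-suc f {g = g} refl refl f≗g = trans (count-sum f)
  (cong (λ s → 𝟙 (f zero) + (𝟙 (f (suc zero)) + s))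
        (trans (sum-cong-≗ (cong 𝟙 ∘ f≗g)) (sym (count-sum g))))

count-false : ∀ n → count {n} (λ _ → false) ≡ 0
count-false n = trans (count-sum {n} (λ _ → false)) (sum-replicate-zero n)

count-== : ∀ {n} (w : Fin n) → count (_== w) ≡ 1
count-== {n} w = begin
  count (_== w)                        ≡⟨ count-sum (_== w) ⟩
  sum (𝟙 ∘ (_== w))                    ≡⟨ +-identityʳ _ ⟨
  sum (𝟙 ∘ (_== w)) + 0
    ≡⟨ sum-update w (λ x x≢w → cong 𝟙 (≢⇒==-false x≢w)) ⟩
  sum {n} (λ _ → 0) + 𝟙 (w == w)
    ≡⟨ cong₂ _+_ (sum-replicate-zero n) (cong 𝟙 (==-refl w)) ⟩
  1                                    ∎
  where open ≡-Reasoning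

count-remove : ∀ {n} (w : Fin n) (f : Fin n → Bool) →
  count f ≡ 𝟙 (f w) + count (λ x → if x == w then false else f x)
count-remove w f = begin
  count f                 ≡⟨ count-sum f ⟩
  sum (𝟙 ∘ f)             ≡⟨ +-identityʳ _ ⟨
  sum (𝟙 ∘ f) + 0         ≡⟨ cong (sum (𝟙 ∘ f) +_) removed ⟨
  sum (𝟙 ∘ f) + 𝟙 (f′ w)  ≡⟨ sum-update w agree ⟩
  sum (𝟙 ∘ f′) + 𝟙 (f w)  ≡⟨ +-comm _ (𝟙 (f w)) ⟩
  𝟙 (f w) + sum (𝟙 ∘ f′)  ≡⟨ cong (𝟙 (f w) +_) (count-sum f′) ⟨
  𝟙 (f w) + count f′      ∎
  where
  open ≡-Reasoning
  f′ : _ → Bool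
  f′ x = if x == w then false else f x
  removed : 𝟙 (f′ w) ≡ 0
  removed = cong (λ b → 𝟙 (if b then false else f w)) (==-refl w)
  agree : ∀ x → x ≢ w → 𝟙 (f x) ≡ 𝟙 (f′ x)
  agree x x≢w = sym (cong (λ b → 𝟙 (if b then false else f x)) (≢⇒==-false x≢w))

count-removed-≤ : ∀ {n} (w : Fin n) (f : Fin n → Bool) →
  count (λ x → if x == w then false else f x) ≤ count f
count-removed-≤ w f =
  ≤-trans (m≤n+m _ (𝟙 (f w))) (≤-reflexive (sym (count-remove w f)))

count-∨ : ∀ {n} (f g : Fin n → Bool) → count (λ x → f x ∨ g x) ≤ count f + count g
count-∨ f g = begin
  count (λ x → f x ∨ g x)        ≡⟨ count-sum (λ x → f x ∨ g x) ⟩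
  sum (λ x → 𝟙 (f x ∨ g x))      ≤⟨ sum-mono-≤ (λ x → 𝟙-∨ (f x) (g x)) ⟩
  sum (λ x → 𝟙 (f x) + 𝟙 (g x))  ≡⟨ ∑-distrib-+ (𝟙 ∘ f) (𝟙 ∘ g) ⟩
  sum (𝟙 ∘ f) + sum (𝟙 ∘ g)      ≡⟨ cong₂ _+_ (count-sum f) (count-sum g) ⟨
  count f + count g              ∎
  where open ≤-Reasoning

count-partition : ∀ {n} (f c : Fin n → Bool) →
  count (λ x → f x ∧ c x) + count (λ x → f x ∧ not (c x)) ≡ count f
count-partition f c = begin
  count (λ x → f x ∧ c x) + count (λ x → f x ∧ not (c x))
    ≡⟨ cong₂ _+_ (count-sum (λ x → f x ∧ c x))
                 (count-sum (λ x → f x ∧ not (c x))) ⟩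
  sum (λ x → 𝟙 (f x ∧ c x)) + sum (λ x → 𝟙 (f x ∧ not (c x)))
    ≡⟨ ∑-distrib-+ (λ x → 𝟙 (f x ∧ c x)) (λ x → 𝟙 (f x ∧ not (c x))) ⟨
  sum (λ x → 𝟙 (f x ∧ c x) + 𝟙 (f x ∧ not (c x)))
    ≡⟨ sum-cong-≗ (λ x → 𝟙-∧-not (f x) (c x)) ⟩
  sum (𝟙 ∘ f)                ≡⟨ count-sum f ⟨
  count f                    ∎
  where open ≡-Reasoning

balanced-excess : ∀ {a b} → a ≤ suc b → b ≤ suc a → 4 < a + b →
  (a ∸ 2) + (b ∸ 2) < a + b ∸ 3
balanced-excess {0} _ z≤n ()
balanced-excess {0} _ (s≤s z≤n) (s≤s ())
balanced-excess {1} _ z≤n (s≤s ())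
balanced-excess {1} _ (s≤s z≤n) (s≤s (s≤s ()))
balanced-excess {1} _ (s≤s (s≤s z≤n)) (s≤s (s≤s (s≤s ())))
balanced-excess {suc (suc _)} {0} (s≤s ()) _ _
balanced-excess {2} {1} _ _ (s≤s (s≤s (s≤s ())))
balanced-excess {suc (suc (suc _))} {1} (s≤s (s≤s ())) _ _
balanced-excess {suc (suc a)} {suc (suc b)} _ _ _
  rewrite +-suc a (suc b) | +-suc a b = n<1+n (a + b)

excess : ∀ {n} → (Fin n → ℕ) → ℕ
excess δ = sum (λ x → δ x ∸ 3)

excess-< : ∀ {n} (δ : Fin n → ℕ) (δ′ : Fin (suc (suc n)) → ℕ) (w : Fin n) →
  (∀ x → x ≢ w → δ′ (suc (suc x)) ≡ δ x) →
  (δ′ zero ∸ 3) + (δ′ (suc zero) ∸ 3) + (δ′ (suc (suc w)) ∸ 3) < δ w ∸ 3 →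
  excess δ′ < excess δ
excess-< δ δ′ w agree new< =
  +-cancelʳ-< (h w) (excess δ′) (excess δ) (begin-strict
  e₀ + (e₁ + sum g) + h w   ≡⟨ regroup e₀ e₁ (sum g) (h w) ⟩
  e₀ + e₁ + (sum g + h w)   ≡⟨ cong (e₀ + e₁ +_) (sum-update w agree-excess) ⟩
  e₀ + e₁ + (sum h + g w)   ≡⟨ regroup′ (e₀ + e₁) (sum h) (g w) ⟩
  e₀ + e₁ + g w + sum h     <⟨ +-monoˡ-< (sum h) new< ⟩
  h w + sum h               ≡⟨ +-comm (h w) (sum h) ⟩
  sum h + h w               ∎)
  where
  open ≤-Reasoning
  g h : _ → ℕ
  g x = δ′ (suc (suc x)) ∸ 3
  h x = δ x ∸ 3
  e₀ = δ′ zero ∸ 3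
  e₁ = δ′ (suc zero) ∸ 3
  agree-excess : ∀ x → x ≢ w → g x ≡ h x
  agree-excess x = cong (_∸ 3) ∘ agree x
  regroup : ∀ a b c d → a + (b + c) + d ≡ a + b + (c + d)
  regroup = solve-∀
  regroup′ : ∀ a b c → a + (b + c) ≡ a + c + b
  regroup′ = solve-∀

module _ {n} (G : Digraph n) (w : Fin n) (chi : Fin n → Bool) where
  private
    G′ = inSplit G w chi

  indeg-inSplit-q : indeg G′ zero ≤ suc (count (λ u → G u w ∧ chi u))
  indeg-inSplit-q = begin
    indeg G′ zero
      ≡⟨ count-suc-suc (λ u → G′ u zero) refl refl (λ _ → refl) ⟩
    count (λ x → (x == w) ∨ (G x w ∧ chi x))
      ≤⟨ count-∨ (_== w) (λ x → G x w ∧ chi x) ⟩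
    count (_== w) + count (λ x → G x w ∧ chi x)
      ≡⟨ cong (_+ count (λ x → G x w ∧ chi x)) (count-== w) ⟩
    suc (count (λ u → G u w ∧ chi u))
      ∎
    where open ≤-Reasoning

  indeg-inSplit-t : indeg G′ (suc zero) ≡ 2
  indeg-inSplit-t =
    trans (count-suc-suc (λ u → G′ u (suc zero)) refl refl (λ _ → refl))
          (cong suc (count-== w))

  indeg-inSplit-p : indeg G′ (suc (suc w)) ≤ suc (count (λ u → G u w ∧ not (chi u)))
  indeg-inSplit-p = begin
    indeg G′ (suc (suc w))
      ≡⟨ count-suc-suc (λ u → G′ u (suc (suc w)))
           (==-refl w) (cong (if_then false else G w w) (==-refl w)) arc-into-p ⟩
    suc (count (λ x → if x == w then false else (G x w ∧ not (chi x))))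
      ≤⟨ s≤s (count-removed-≤ w (λ x → G x w ∧ not (chi x))) ⟩
    suc (count (λ u → G u w ∧ not (chi u)))
      ∎
    where
    open ≤-Reasoning
    arc-into-p : ∀ x → G′ (suc (suc x)) (suc (suc w)) ≡
                       (if x == w then false else (G x w ∧ not (chi x)))
    arc-into-p x rewrite ==-refl w = refl

  indeg-inSplit-old : ∀ x → x ≢ w → indeg G′ (suc (suc x)) ≡ indeg G x
  indeg-inSplit-old x x≢w = begin
    indeg G′ (suc (suc x))
      ≡⟨ count-suc-suc (λ u → G′ u (suc (suc x))) (≢⇒==-false x≢w)
           (cong (if_then false else G w x) (≢⇒==-false x≢w)) arc-into-x ⟩
    𝟙 (G w x) + count (λ u → if u == w then false else G u x)
      ≡⟨ count-remove w (λ u → G u x) ⟨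
    indeg G x
      ∎
    where
    open ≡-Reasoning
    arc-into-x : ∀ u → G′ (suc (suc u)) (suc (suc x)) ≡ (if u == w then false else G u x)
    arc-into-x u rewrite ≢⇒==-false x≢w = refl

  inSplit-excess-< : 4 < indeg G w → BalancedIn G w chi →
    excess (indeg G′) < excess (indeg G)
  inSplit-excess-< 4<deg (a≤b+1 , b≤a+1) =
    excess-< (indeg G) (indeg G′) w indeg-inSplit-old (begin-strict
      (indeg G′ zero ∸ 3) + (indeg G′ (suc zero) ∸ 3) + (indeg G′ (suc (suc w)) ∸ 3)
        ≤⟨ +-mono-≤ (+-mono-≤ (∸-monoˡ-≤ 3 indeg-inSplit-q)
                              (≤-reflexive (cong (_∸ 3) indeg-inSplit-t)))
                    (∸-monoˡ-≤ 3 indeg-inSplit-p) ⟩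
      (a ∸ 2) + 0 + (b ∸ 2)      ≡⟨ cong (_+ (b ∸ 2)) (+-identityʳ (a ∸ 2)) ⟩
      (a ∸ 2) + (b ∸ 2)          <⟨ balanced-excess a≤b+1 b≤a+1 (subst (4 <_) (sym a+b≡deg) 4<deg) ⟩
      a + b ∸ 3                  ≡⟨ cong (_∸ 3) a+b≡deg ⟩
      indeg G w ∸ 3              ∎)
    where
    open ≤-Reasoning
    a = count (λ u → G u w ∧ chi u)
    b = count (λ u → G u w ∧ not (chi u))
    a+b≡deg : a + b ≡ indeg G w
    a+b≡deg = count-partition (λ u → G u w) chi

module _ {n} (G : Digraph n) (w : Fin n) (chi : Fin n → Bool) where
  private
    G′ = outSplit G w chi

  outdeg-outSplit-q : outdeg G′ zero ≡ suc (count (λ u → G w u ∧ chi u))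
  outdeg-outSplit-q = count-suc-suc (G′ zero) refl refl (λ _ → refl)

  outdeg-outSplit-t : outdeg G′ (suc zero) ≡ suc (count (λ u → G w u ∧ not (chi u)))
  outdeg-outSplit-t = count-suc-suc (G′ (suc zero)) refl refl (λ _ → refl)

  outdeg-outSplit-p : outdeg G′ (suc (suc w)) ≡ 2
  outdeg-outSplit-p =
    trans (count-suc-suc (G′ (suc (suc w))) (==-refl w) (==-refl w)
                         (λ y → cong (if_then false else G w y) (==-refl w)))
          (cong (2 +_) (count-false n))

  outdeg-outSplit-old : ∀ x → x ≢ w → outdeg G′ (suc (suc x)) ≡ outdeg G x
  outdeg-outSplit-old x x≢w =
    count-suc-suc (G′ (suc (suc x))) (≢⇒==-false x≢w) (≢⇒==-false x≢w)
                  (λ y → cong (if_then false else G x y) (≢⇒==-false x≢w))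

  outSplit-excess-< : 4 < outdeg G w → BalancedOut G w chi →
    excess (outdeg G′) < excess (outdeg G)
  outSplit-excess-< 4<deg (a≤b+1 , b≤a+1) =
    excess-< (outdeg G) (outdeg G′) w outdeg-outSplit-old (begin-strict
      (outdeg G′ zero ∸ 3) + (outdeg G′ (suc zero) ∸ 3) + (outdeg G′ (suc (suc w)) ∸ 3)
        ≡⟨ cong₂ _+_ (cong₂ _+_ (cong (_∸ 3) outdeg-outSplit-q)
                                (cong (_∸ 3) outdeg-outSplit-t))
                     (cong (_∸ 3) outdeg-outSplit-p) ⟩
      (a ∸ 2) + (b ∸ 2) + 0      ≡⟨ +-identityʳ _ ⟩
      (a ∸ 2) + (b ∸ 2)          <⟨ balanced-excess a≤b+1 b≤a+1 (subst (4 <_) (sym a+b≡deg) 4<deg) ⟩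
      a + b ∸ 3                  ≡⟨ cong (_∸ 3) a+b≡deg ⟩
      outdeg G w ∸ 3             ∎)
    where
    open ≤-Reasoning
    a = count (λ u → G w u ∧ chi u)
    b = count (λ u → G w u ∧ not (chi u))
    a+b≡deg : a + b ≡ outdeg G w
    a+b≡deg = count-partition (G w) chi

module _ {d : ℕ} (4≤d : 4 ≤ d) where

  outPhase-terminates : ∀ {n} (G : Digraph n) (S : Fin n → Bool) →
    Acc _<_ (excess (outdeg G)) → Terminates d (state n G S outPhase)
  outPhase-terminates G S (acc smaller) = acc λ where
    (stepOut .G .S w chi _ d<deg balanced) → outPhase-terminates _ _
      (smaller (outSplit-excess-< G w chi (≤-<-trans 4≤d d<deg) balanced))

  inPhase-terminates : ∀ {n} (G : Digraph n) (S : Fin n → Bool) →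
    Acc _<_ (excess (indeg G)) → Terminates d (state n G S inPhase)
  inPhase-terminates G S (acc smaller) = acc λ where
    (stepIn .G .S w chi _ d<deg balanced) → inPhase-terminates _ _
      (smaller (inSplit-excess-< G w chi (≤-<-trans 4≤d d<deg) balanced))
    (stepOutStart .G .S w chi _ _ _ _) → outPhase-terminates _ _ (<-wellFounded _)

lemma5p1 : (d : ℕ) → 4 ≤ d → (n : ℕ) (G : Digraph n) → Loopless G →
    (v : Fin n) → d < indeg G v ⊔ outdeg G v → Terminates d (initial G v)
lemma5p1 d 4≤d n G _ v _ = acc λ where
  (stepSplit .G .(λ _ → false) .v) → inPhase-terminates 4≤d _ _ (<-wellFounded _)
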